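{- For all $m\ge 0$ and $r,k,s>0$, the game $\mathrm{G}^{m,r,k,s}$ is an Ehrenfeucht–Fraïssé game for the logic $\mathcal L^{m,r,k,s}$; that is, for every signature $\tau$ and all finite $\tau$-structures $\mathscr A,\mathscr B$, the following are equivalent: (1) $\mathscr A$ and $\mathscr B$ satisfy the same $\mathcal L^{m,r,k,s}[\tau]$-sentences; (2) the duplicator has a winning strategy in $\mathrm{G}^{m,r,k,s}(\mathscr A,\mathscr B)$.
   Context: $\log(n)=\lceil\log_2 n\rceil$, $\log^k(n)=(\log(n))^k$. $\mathscr L^s_{\infty\omega}$ is infinitary logic (first-order logic allowing arbitrary infinite conjunctions and disjunctions) with at most $s$ element variables, and $\mathscr L^\omega_{\infty\omega}=\bigcup_s\mathscr L^s_{\infty\omega}$. For $k>0$, $\exists^{\log^k}$ is the second-order quantifier with $\mathscr A\models\exists^{\log^k}X\phi$ iff there is $S\subseteq A^{\mathrm{arity}(X)}$ with $|S|\le\log^k(|A|)$ such that $\mathscr A\models\phi[X/S]$, and $\forall^{\log^k}X:=\neg\exists^{\log^k}X\neg$. The logic $\mathcal L$ is the smallest class of formulas containing $\mathscr L^\omega_{\infty\omega}$ and closed under $\exists^{\log^k}X\phi$, $\forall^{\log^k}X\phi$ ($k>0$, $X$ a relation variable), $\psi\wedge\chi$ and $\psi\vee\chi$. For $\phi\in\mathcal L$: $lqr(\phi)$ (log-quantifier rank) is defined by $lqr=0$ for atomic formulas, unchanged by negation and first-order quantification, max over the two sides of a binary connective, and $lqr(\exists^{\log^k}X\psi)=lqr(\psi)+1$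 (similarly for $\forall^{\log^k}$); $mva(\phi)$ is the maximal arity of a relation variable (free or bound by a log-quantifier) in $\phi$; $height(\phi)$ is the maximal $k$ such that $\exists^{\log^k}$ or $\forall^{\log^k}$ occurs in $\phi$. $\mathcal L^{m,r,k,s}$ is the set of $\phi\in\mathcal L$ with $lqr(\phi)\le m$, $mva(\phi)\le r$, $height(\phi)\le k$ and at most $s$ element variables. The pebble game $\mathrm{PG}^s(\mathscr A,\mathscr B)$ is played by spoiler and duplicator with $s$ pairs of pebbles; in each round the spoiler places (or moves) a pebble on an element of one structure and the duplicator answers with the corresponding pebble on the other structure; the duplicator wins if at every stage the map sending pebbled elements of $\mathscr A$ to the correspondingly pebbled elements of $\mathscr B$ is a partial isomorphism (respecting all relations, including any expansion relations). The game $\mathrm{G}^{m,r,k,s}(\mathscr A,\mathscr B)$: the spoiler chooses $m'\le m$, and $m'$ relation moves are played. In a relation move the spoiler chooses $r'\le r$, $k'\le k$, one of the two structures, say $\mathscr A$ (otherwise roles of $\mathscr A,\mathscr B$ swap), and a relation $R\subseteq A^{r'}$ with $|R|\le\log^{k'}(|A|)$; the duplicator answers with $S\subseteq B^{r'}$ with $|S|\le\log^{k'}(|B|)$. After the relation moves, giving expansions $\langle\mathscr A,R_1,\dots,R_{m'}\rangle$ and $\langle\mathscr B,S_1,\dots,S_{m'}\rangle$ (where $R_i$ and $S_i$ are the relations, in the respective structures, chosen in the $i$-th move), the players play $\mathrm{PG}^s$ on these expansions, and the duplicator wins the play iff she wins this pebble game. She wins $\mathrm{G}^{m,r,k,s}(\mathscr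 A,\mathscr B)$ if she has a strategy winning every play. -}

module Defs where

open import Level using (0ℓ)
open import Data.Nat using (ℕ; zero; suc; _≤_; _<_; _⊔_; _^_)
open import Data.Nat.Logarithm using (⌈log₂_⌉)
open import Data.Fin using (Fin; _≟_)
open import Data.Vec using (Vec; map)
open import Data.Vec.Relation.Unary.All using (All)
open import Data.List using (List; []; _∷_; length)
open import Data.List.Membership.Propositional using (_∈_)
open import Data.Maybe using (Maybe; just; nothing)
open import Data.Bool using (Bool; true; false; if_then_else_)
open import Data.Product using (Σ; _×_; _,_; proj₁; proj₂; ∃)
open import Data.Sum using (_⊎_; inj₁; inj₂)
open import Data.Empty using (⊥)
open import Relation.Nullary using (¬_; does)
open import Relation.Binary.PropositionalEquality using (_≡_)
open import Function.Bundles using (_⇔_)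

logPow : ℕ → ℕ → ℕ
logPow k n = ⌈log₂ n ⌉ ^ k

record Signature : Set₁ where
  field
    Sym   : Set
    arity : Sym → ℕ
open Signature public

record Structure (τ : Signature) : Set where
  field
    size     : ℕ
    nonempty : 0 < size
    rel      : (R : Sym τ) → Vec (Fin size) (arity τ R) → Bool
open Structure public

-- Relation variables: a context Γ is the list of arities of the relation
-- variables in scope (de Bruijn, innermost first).

data RVar : List ℕ → ℕ → Set where
  here  : ∀ {a Γ} → RVar (a ∷ Γ) a
  there : ∀ {a b Γ} → RVar Γ a → RVar (b ∷ Γ) a

-- An interpretation of a relation-variable context over a set D:
-- each variable of arity a is interpreted by a finite set of a-tuples,
-- given as a list (its set of members).  A list of length ≤ N denotes a
-- set of size ≤ N, and every set of size ≤ N is denoted by such a list.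

data REnv (D : Set) : List ℕ → Set where
  []  : REnv D []
  _∷_ : ∀ {a Γ} → List (Vec D a) → REnv D Γ → REnv D (a ∷ Γ)

lookupR : ∀ {D Γ a} → REnv D Γ → RVar Γ a → List (Vec D a)
lookupR (S ∷ ρ) here      = S
lookupR (S ∷ ρ) (there x) = lookupR ρ x

update : ∀ {s} {D : Set} → (Fin s → D) → Fin s → D → (Fin s → D)
update α i d j = if does (j ≟ i) then d else α j

data FO (τ : Signature) (s : ℕ) (Γ : List ℕ) : Set₁ where
  atom  : (R : Sym τ) → Vec (Fin s) (arity τ R) → FO τ s Γ
  rvar  : ∀ {a} → RVar Γ a → Vec (Fin s) a → FO τ s Γ
  eq    : Fin s → Fin s → FO τ s Γ
  neg   : FO τ s Γ → FO τ s Γ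
  ex    : Fin s → FO τ s Γ → FO τ s Γ
  all   : Fin s → FO τ s Γ → FO τ s Γ
  conj  : (I : Set) → (I → FO τ s Γ) → FO τ s Γ
  disj  : (I : Set) → (I → FO τ s Γ) → FO τ s Γ

data 𝓛 (τ : Signature) (s : ℕ) (Γ : List ℕ) : Set₁ where
  fo       : FO τ s Γ → 𝓛 τ s Γ
  and      : 𝓛 τ s Γ → 𝓛 τ s Γ → 𝓛 τ s Γ
  or       : 𝓛 τ s Γ → 𝓛 τ s Γ → 𝓛 τ s Γ
  exLog    : (k : ℕ) → 0 < k → (a : ℕ) → 𝓛 τ s (a ∷ Γ) → 𝓛 τ s Γ
  forallLog : (k : ℕ) → 0 < k → (a : ℕ) → 𝓛 τ s (a ∷ Γ) → 𝓛 τ s Γ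

module _ {τ : Signature} {s : ℕ} (𝒜 : Structure τ) where
  private
    A = Fin (size 𝒜)

  satFO : ∀ {Γ} → REnv A Γ → (Fin s → A) → FO τ s Γ → Set
  satFO ρ α (atom R xs)   = rel 𝒜 R (map α xs) ≡ true
  satFO ρ α (rvar X xs)  = map α xs ∈ lookupR ρ X
  satFO ρ α (eq i j)     = α i ≡ α j
  satFO ρ α (neg φ)      = ¬ satFO ρ α φ
  satFO ρ α (ex i φ)     = Σ A λ d → satFO ρ (update α i d) φ
  satFO ρ α (all i φ)    = (d : A) → satFO ρ (update α i d) φ
  satFO ρ α (conj I φs)  = (j : I) → satFO ρ α (φs j)
  satFO ρ α (disj I φs)  = Σ I λ j → satFO ρ α (φs j)

  sat : ∀ {Γ} → REnv A Γ → (Fin s → A) → 𝓛 τ s Γ → Set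
  sat ρ α (fo φ)      = satFO ρ α φ
  sat ρ α (and φ ψ)   = sat ρ α φ × sat ρ α ψ
  sat ρ α (or φ ψ)    = sat ρ α φ ⊎ sat ρ α ψ
  sat ρ α (exLog k _ a φ) =
    Σ (List (Vec A a)) λ S → length S ≤ logPow k (size 𝒜) × sat (S ∷ ρ) α φ
  sat ρ α (forallLog k _ a φ) =
    ¬ (Σ (List (Vec A a)) λ S → length S ≤ logPow k (size 𝒜) × ¬ sat (S ∷ ρ) α φ)

  -- truth of a sentence (its value does not depend on the assignment)
  _⊨_ : 𝓛 τ s [] → Set
  _⊨_ φ = (α : Fin s → A) → sat [] α φ

module _ {τ : Signature} {s : ℕ} where
  FreeFO : ∀ {Γ} → Fin s → FO τ s Γ → Set
  FreeFO i (atom R xs)  = Data.Vec.Membership.Propositional._∈_ i xs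
    where import Data.Vec.Membership.Propositional
  FreeFO i (rvar X xs) = Data.Vec.Membership.Propositional._∈_ i xs
    where import Data.Vec.Membership.Propositional
  FreeFO i (eq j l)    = (i ≡ j) ⊎ (i ≡ l)
  FreeFO i (neg φ)     = FreeFO i φ
  FreeFO i (ex j φ)    = ¬ (i ≡ j) × FreeFO i φ
  FreeFO i (all j φ)   = ¬ (i ≡ j) × FreeFO i φ
  FreeFO i (conj I φs) = Σ I λ j → FreeFO i (φs j)
  FreeFO i (disj I φs) = Σ I λ j → FreeFO i (φs j)

  Free : ∀ {Γ} → Fin s → 𝓛 τ s Γ → Set
  Free i (fo φ)              = FreeFO i φ
  Free i (and φ ψ)           = Free i φ ⊎ Free i ψ
  Free i (or φ ψ)            = Free i φ ⊎ Free i ψ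
  Free i (exLog k _ a φ)     = Free i φ
  Free i (forallLog k _ a φ) = Free i φ

  Sentence : 𝓛 τ s [] → Set
  Sentence φ = (i : Fin s) → ¬ Free i φ

-- lqr, height (natural numbers) and "mva ≤ r" (a predicate, since the
-- first-order part may be infinitary)

  lqr : ∀ {Γ} → 𝓛 τ s Γ → ℕ
  lqr (fo φ)              = 0
  lqr (and φ ψ)           = lqr φ ⊔ lqr ψ
  lqr (or φ ψ)            = lqr φ ⊔ lqr ψ
  lqr (exLog k _ a φ)     = suc (lqr φ)
  lqr (forallLog k _ a φ) = suc (lqr φ)

  height : ∀ {Γ} → 𝓛 τ s Γ → ℕ
  height (fo φ)              = 0
  height (and φ ψ)           = height φ ⊔ height ψ
  height (or φ ψ)            = height φ ⊔ height ψ
  height (exLog k _ a φ)     = k ⊔ height φ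
  height (forallLog k _ a φ) = k ⊔ height φ

  MvaFO≤ : ∀ {Γ} → ℕ → FO τ s Γ → Set
  MvaFO≤ r (atom R xs)           = Data.Unit.⊤ where import Data.Unit
  MvaFO≤ r (rvar {a} X xs)      = a ≤ r
  MvaFO≤ r (eq i j)             = Data.Unit.⊤ where import Data.Unit
  MvaFO≤ r (neg φ)              = MvaFO≤ r φ
  MvaFO≤ r (ex i φ)             = MvaFO≤ r φ
  MvaFO≤ r (all i φ)            = MvaFO≤ r φ
  MvaFO≤ r (conj I φs)          = (j : I) → MvaFO≤ r (φs j)
  MvaFO≤ r (disj I φs)          = (j : I) → MvaFO≤ r (φs j)

  Mva≤ : ∀ {Γ} → ℕ → 𝓛 τ s Γ → Set
  Mva≤ r (fo φ)              = MvaFO≤ r φ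
  Mva≤ r (and φ ψ)           = Mva≤ r φ × Mva≤ r ψ
  Mva≤ r (or φ ψ)            = Mva≤ r φ × Mva≤ r ψ
  Mva≤ r (exLog k _ a φ)     = a ≤ r × Mva≤ r φ
  Mva≤ r (forallLog k _ a φ) = a ≤ r × Mva≤ r φ

In𝓛 : ∀ {τ} (m r k s : ℕ) → 𝓛 τ s [] → Set
In𝓛 m r k s φ = lqr φ ≤ m × Mva≤ r φ × height φ ≤ k

Equiv𝓛 : ∀ {τ} (m r k s : ℕ) → Structure τ → Structure τ → Set₁
Equiv𝓛 {τ} m r k s 𝒜 ℬ =
  (φ : 𝓛 τ s []) → In𝓛 m r k s φ → Sentence φ → (_⊨_ 𝒜 φ ⇔ _⊨_ ℬ φ)

module PebbleGame {τ : Signature} (s : ℕ) (𝒜 ℬ : Structure τ)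
                  {Γ : List ℕ} (ρA : REnv (Fin (size 𝒜)) Γ)
                  (ρB : REnv (Fin (size ℬ)) Γ) where
  A = Fin (size 𝒜)
  B = Fin (size ℬ)

  Position : Set
  Position = Fin s → Maybe (A × B)

  initial : Position
  initial _ = nothing

  Pebbled : Position → A × B → Set
  Pebbled p ab = ∃ λ i → p i ≡ just ab

  PartialIso : Position → Set
  PartialIso p =
      (∀ ab ab′ → Pebbled p ab → Pebbled p ab′ →
         (proj₁ ab ≡ proj₁ ab′ ⇔ proj₂ ab ≡ proj₂ ab′))
    × (∀ (R : Sym τ) (t : Vec (A × B) (arity τ R)) → All (Pebbled p) t →
         rel 𝒜 R (map proj₁ t) ≡ rel ℬ R (map proj₂ t))
    × (∀ {a} (X : RVar Γ a) (t : Vec (A × B) a) → All (Pebbled p) t →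
         (map proj₁ t ∈ lookupR ρA X ⇔ map proj₂ t ∈ lookupR ρB X))

  Move : Set
  Move = Fin s × (A ⊎ B)

  Reply : Move → Set
  Reply (_ , inj₁ _) = B
  Reply (_ , inj₂ _) = A

  placed : (mv : Move) → Reply mv → A × B
  placed (_ , inj₁ a) b = a , b
  placed (_ , inj₂ b) a = a , b

  -- a duplicator strategy: reply to a move given the history of previous
  -- spoiler moves (most recent first)
  Strategy : Set
  Strategy = List Move → (mv : Move) → Reply mv

  position : Strategy → List Move → Position
  position σ []        = initial
  position σ (mv ∷ h)  = update (position σ h) (proj₁ mv) (just (placed mv (σ h mv)))

  Winning : Strategy → Set
  Winning σ = (h : List Move) → PartialIso (position σ h)

  DuplicatorWins : Set
  DuplicatorWins = Σ Strategy Winning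

module _ {τ : Signature} (r k s : ℕ) (𝒜 ℬ : Structure τ) where
  private
    A = Fin (size 𝒜)
    B = Fin (size ℬ)

  -- duplicator wins from a stage where j relation moves remain and the
  -- relations chosen so far are ρA, ρB
  GWin : (j : ℕ) {Γ : List ℕ} → REnv A Γ → REnv B Γ → Set
  GWin zero    ρA ρB = PebbleGame.DuplicatorWins s 𝒜 ℬ ρA ρB
  GWin (suc j) ρA ρB =
    (r′ k′ : ℕ) → r′ ≤ r → 0 < k′ → k′ ≤ k →
      ((R : List (Vec A r′)) → length R ≤ logPow k′ (size 𝒜) →
         Σ (List (Vec B r′)) λ S → length S ≤ logPow k′ (size ℬ) ×
           GWin j (R ∷ ρA) (S ∷ ρB))
    × ((S : List (Vec B r′)) → length S ≤ logPow k′ (size ℬ) →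
         Σ (List (Vec A r′)) λ R → length R ≤ logPow k′ (size 𝒜) ×
           GWin j (R ∷ ρA) (S ∷ ρB))

-- (2) the duplicator has a winning strategy in G^{m,r,k,s}(𝒜, ℬ):
-- whatever m′ ≤ m the spoiler chooses
DupWinsG : ∀ {τ} (m r k s : ℕ) → Structure τ → Structure τ → Set
DupWinsG m r k s 𝒜 ℬ = (m′ : ℕ) → m′ ≤ m → GWin r k s 𝒜 ℬ m′ [] []

-- Winning implies agreement: by induction on a formula of log-quantifier rank at most j,
-- a game position with j relation moves left gives both expansions the same truth value.
-- The duplicator's answers to relation moves take care of the log-quantifiers, and her
-- winning strategy in the s-pebble game takes care of the first-order part, whose formulas
-- use only s element variables.
--
-- Agreement implies winning: since 𝒜 is finite, the game with j relation moves left after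
-- the moves ρ on 𝒜 is described by one sentence χ j ρ of the logic. For j = 0 it is the
-- infinitary conjunction of the Hintikka formulas of every depth of the s-pebble game; for
-- j + 1 it says, for every admissible relation move on 𝒜, which moves on the other
-- structure answer it, and vice versa. 𝒜 satisfies χ m [], hence so does ℬ, and the
-- duplicator follows the witnesses in ℬ. In the pebble game one answer has to realise the
-- Hintikka formulas of all depths at once; it exists because there are only finitely many
-- candidates.

module Submission where

open import Defs
open import Level using (0ℓ)
open import Axiom.ExcludedMiddle using (ExcludedMiddle)
open import Axiom.DoubleNegationElimination using (em⇒dne)
open import Data.Nat
  using (ℕ; zero; suc; _≤_; _<_; _⊔_; _+_; z≤n; s≤s; s≤s⁻¹; _≤′_; ≤′-refl; ≤′-step)
open import Data.Nat.Properties
  using (≤-refl; ≤-trans; ≤⇒≤′; m⊔n≤o⇒m≤o; m⊔n≤o⇒n≤o; ⊔-lub; m≤m+n; m≤n+m)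
open import Data.Fin using (Fin; _≟_; fromℕ<)
import Data.Fin as Fin
open import Data.Vec using (Vec; []; _∷_; map)
open import Data.Vec.Properties using (map-∘)
open import Data.Vec.Relation.Unary.All using (All; []; _∷_)
import Data.Vec.Relation.Unary.All as All
import Data.Vec.Membership.Propositional as Vec
open import Data.Vec.Relation.Unary.Any using (here; there)
open import Data.List using (List; []; _∷_; [_]; length; upTo; allFin; cartesianProductWith)
open import Data.List.Membership.Propositional using (_∈_)
open import Data.List.Membership.Propositional.Properties
  using (∈-upTo⁺; ∈-upTo⁻; ∈-allFin; ∈-cartesianProductWith⁺; ∈-cartesianProductWith⁻)
import Data.List.Relation.Unary.All as List
import Data.List.Relation.Unary.Any as Any
open import Data.Bool using (Bool; true; false)
open import Data.Maybe using (Maybe; just; nothing; fromMaybe)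
open import Data.Maybe.Properties using (just-injective)
import Data.Maybe as Maybe
open import Data.Product using (Σ; ∃; _×_; _,_; proj₁; proj₂)
open import Data.Sum using (_⊎_; inj₁; inj₂)
open import Data.Empty using (⊥; ⊥-elim)
open import Data.Unit using (tt)
open import Relation.Nullary using (¬_; Dec; yes; no)
open import Relation.Binary.PropositionalEquality
  using (_≡_; refl; sym; trans; cong; cong₂; subst; subst₂; module ≡-Reasoning)
open import Function.Bundles using (_⇔_; mk⇔; Equivalence)
open Equivalence using (to; from)
open import Function.Related.Propositional using (≡⇒)
open import Function.Related.TypeIsomorphisms using (¬-cong-⇔)
open import Data.Product.Function.NonDependent.Propositional using (_×-⇔_)
open import Data.Sum.Function.Propositional using (_⊎-⇔_)
open import Function using (_∘_)

rvar-arity≤ : ∀ {r Γ a} → List.All (_≤ r) Γ → RVar Γ a → a ≤ r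
rvar-arity≤ (a≤r List.∷ _)   here      = a≤r
rvar-arity≤ (_   List.∷ Γ≤r) (there X) = rvar-arity≤ Γ≤r X

point : ∀ {τ} (𝒞 : Structure τ) → Fin (size 𝒞)
point 𝒞 = fromℕ< (nonempty 𝒞)

≡true-⇔⇒≡ : ∀ {x y : Bool} → (x ≡ true ⇔ y ≡ true) → x ≡ y
≡true-⇔⇒≡ {false} {false} _ = refl
≡true-⇔⇒≡ {false} {true}  e = from e refl
≡true-⇔⇒≡ {true}  {false} e = sym (to e refl)
≡true-⇔⇒≡ {true}  {true}  _ = refl

module Classical (em : ExcludedMiddle 0ℓ) where

  ¬∀⇒∃¬ : {X : Set} {Q : X → Set} → ¬ (∀ x → Q x) → ∃ λ x → ¬ Q x
  ¬∀⇒∃¬ ¬∀Q = em⇒dne em λ ¬∃¬Q → ¬∀Q λ x → em⇒dne em λ ¬Qx → ¬∃¬Q (x , ¬Qx)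

  module _ {n : ℕ} (P : ℕ → Fin n → Set) (antitone : ∀ {m b} → P (suc m) b → P m b) where

    antitone-≤ : ∀ {m m′ b} → m ≤ m′ → P m′ b → P m b
    antitone-≤ = go ∘ ≤⇒≤′
      where
      go : ∀ {m m′ b} → m ≤′ m′ → P m′ b → P m b
      go ≤′-refl       p = p
      go (≤′-step m≤′) p = go m≤′ (antitone p)

  common-witness : ∀ n (P : ℕ → Fin n → Set) → (∀ {m b} → P (suc m) b → P m b) →
                   (∀ m → ∃ (P m)) → ∃ λ b → ∀ m → P m b
  common-witness zero P antitone witness with witness 0
  ... | () , _
  common-witness (suc n) P antitone witness with em {∀ m → P m Fin.zero}
  ... | yes P-zero = Fin.zero , P-zero
  ... | no ¬P-zero with (m₀ , ¬Pm₀) ← ¬∀⇒∃¬ ¬P-zero =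
    let (b , P′b) = common-witness n P′ antitone shifted
    in Fin.suc b , λ m → antitone-≤ P antitone (m≤m+n m m₀) (P′b m)
    where
    P′ : ℕ → Fin n → Set
    P′ m b = P (m + m₀) (Fin.suc b)

    shifted : ∀ m → ∃ (P′ m)
    shifted m with witness (m + m₀)
    ... | Fin.zero  , P0 = ⊥-elim (¬Pm₀ (antitone-≤ P antitone (m≤n+m m₀ m) P0))
    ... | Fin.suc b , Pb = b , Pb

module _ {X : Set} where

  vectors : (a : ℕ) → List X → List (Vec X a)
  vectors zero    U = [ [] ]
  vectors (suc a) U = cartesianProductWith _∷_ U (vectors a U)

  ∈-vectors : ∀ {a U} → (∀ x → x ∈ U) → (v : Vec X a) → v ∈ vectors a U
  ∈-vectors total []      = Any.here refl
  ∈-vectors total (x ∷ v) = ∈-cartesianProductWith⁺ _∷_ (total x) (∈-vectors total v)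

  lists≤ : ℕ → List X → List (List X)
  lists≤ zero    U = [ [] ]
  lists≤ (suc N) U = [] ∷ cartesianProductWith _∷_ U (lists≤ N U)

  ∈-lists≤⁺ : ∀ {N U} → (∀ x → x ∈ U) → (R : List X) → length R ≤ N → R ∈ lists≤ N U
  ∈-lists≤⁺ {zero}  total []      _       = Any.here refl
  ∈-lists≤⁺ {suc N} total []      _       = Any.here refl
  ∈-lists≤⁺ {suc N} total (x ∷ R) (s≤s l) =
    Any.there (∈-cartesianProductWith⁺ _∷_ (total x) (∈-lists≤⁺ total R l))

  ∈-lists≤⁻ : ∀ {N U R} → R ∈ lists≤ N U → length R ≤ N
  ∈-lists≤⁻ {zero}  (Any.here refl) = z≤n
  ∈-lists≤⁻ {suc N} (Any.here refl) = z≤n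
  ∈-lists≤⁻ {suc N} {U} (Any.there R∈) with ∈-cartesianProductWith⁻ _∷_ U (lists≤ N U) R∈
  ... | _ , _ , _ , R′∈ , refl = s≤s (∈-lists≤⁻ R′∈)

module _ {τ : Signature} {s : ℕ} {Γ : List ℕ} where

  ⊤𝓛 ⊥𝓛 : 𝓛 τ s Γ
  ⊤𝓛 = fo (conj ⊥ ⊥-elim)
  ⊥𝓛 = fo (disj ⊥ ⊥-elim)

  module _ {X : Set} where

    ⋀ ⋁ : List X → (X → 𝓛 τ s Γ) → 𝓛 τ s Γ
    ⋀ []       f = ⊤𝓛
    ⋀ (x ∷ xs) f = and (f x) (⋀ xs f)
    ⋁ []       f = ⊥𝓛
    ⋁ (x ∷ xs) f = or (f x) (⋁ xs f)

    module _ (𝒞 : Structure τ) (ρ : REnv (Fin (size 𝒞)) Γ) (γ : Fin s → Fin (size 𝒞)) where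

      sat-⋀ : ∀ xs f → sat 𝒞 ρ γ (⋀ xs f) ⇔ (∀ {x} → x ∈ xs → sat 𝒞 ρ γ (f x))
      sat-⋀ xs f = mk⇔ (elim xs) (intro xs)
        where
        elim : ∀ xs → sat 𝒞 ρ γ (⋀ xs f) → ∀ {x} → x ∈ xs → sat 𝒞 ρ γ (f x)
        elim (x ∷ xs) (fx , _)  (Any.here refl) = fx
        elim (x ∷ xs) (_ , fxs) (Any.there x∈) = elim xs fxs x∈
        intro : ∀ xs → (∀ {x} → x ∈ xs → sat 𝒞 ρ γ (f x)) → sat 𝒞 ρ γ (⋀ xs f)
        intro []       _    = λ ()
        intro (x ∷ xs) sats = sats (Any.here refl) , intro xs (sats ∘ Any.there)

      sat-⋁ : ∀ xs f → sat 𝒞 ρ γ (⋁ xs f) ⇔ (∃ λ x → x ∈ xs × sat 𝒞 ρ γ (f x))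
      sat-⋁ xs f = mk⇔ (elim xs) (λ (x , x∈ , fx) → intro xs x∈ fx)
        where
        elim : ∀ xs → sat 𝒞 ρ γ (⋁ xs f) → ∃ λ x → x ∈ xs × sat 𝒞 ρ γ (f x)
        elim (x ∷ xs) (inj₁ fx)  = x , Any.here refl , fx
        elim (x ∷ xs) (inj₂ fxs) with elim xs fxs
        ... | y , y∈ , fy = y , Any.there y∈ , fy
        intro : ∀ xs {x} → x ∈ xs → sat 𝒞 ρ γ (f x) → sat 𝒞 ρ γ (⋁ xs f)
        intro (x ∷ xs) (Any.here refl) fx = inj₁ fx
        intro (x ∷ xs) (Any.there x∈)  fx = inj₂ (intro xs x∈ fx)

module Bounds {τ : Signature} {s : ℕ} (r k : ℕ) where

  Bounded : ∀ {Γ} → ℕ → 𝓛 τ s Γ → Set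
  Bounded j φ = (lqr φ ≤ j × Mva≤ r φ × height φ ≤ k) × (∀ i → ¬ Free i φ)

  -- Bounded j (and φ ψ) and Bounded j (or φ ψ) both unfold to Bounded₂ j φ ψ.
  Bounded₂ : ∀ {Γ} → ℕ → 𝓛 τ s Γ → 𝓛 τ s Γ → Set
  Bounded₂ j φ ψ =
    (lqr φ ⊔ lqr ψ ≤ j × (Mva≤ r φ × Mva≤ r ψ) × height φ ⊔ height ψ ≤ k)
    × (∀ i → ¬ (Free i φ ⊎ Free i ψ))

  -- Likewise for exLog and forallLog.
  BoundedLog : ∀ {Γ} → ℕ → (k′ a : ℕ) → 𝓛 τ s (a ∷ Γ) → Set
  BoundedLog j k′ a φ =
    (suc (lqr φ) ≤ j × (a ≤ r × Mva≤ r φ) × k′ ⊔ height φ ≤ k) × (∀ i → ¬ Free i φ)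

  module _ {Γ : List ℕ} {j : ℕ} where

    bounded₂⁺ : {φ ψ : 𝓛 τ s Γ} → Bounded j φ → Bounded j ψ → Bounded₂ j φ ψ
    bounded₂⁺ ((lφ , mφ , hφ) , fφ) ((lψ , mψ , hψ) , fψ) =
      (⊔-lub lφ lψ , (mφ , mψ) , ⊔-lub hφ hψ) , λ { i (inj₁ f) → fφ i f ; i (inj₂ f) → fψ i f }

    bounded₂⁻ : {φ ψ : 𝓛 τ s Γ} → Bounded₂ j φ ψ → Bounded j φ × Bounded j ψ
    bounded₂⁻ {φ} {ψ} ((l , (mφ , mψ) , h) , f) =
      ((m⊔n≤o⇒m≤o (lqr φ) _ l , mφ , m⊔n≤o⇒m≤o (height φ) _ h) , λ i → f i ∘ inj₁) ,
      ((m⊔n≤o⇒n≤o (lqr φ) _ l , mψ , m⊔n≤o⇒n≤o (height φ) _ h) , λ i → f i ∘ inj₂)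

    module _ {X : Set} (f : X → 𝓛 τ s Γ) where

      ⋀-bounded : ∀ xs → (∀ {x} → x ∈ xs → Bounded j (f x)) → Bounded j (⋀ xs f)
      ⋀-bounded []       _ = (z≤n , (λ ()) , z≤n) , λ _ ()
      ⋀-bounded (x ∷ xs) b =
        bounded₂⁺ {f x} {⋀ xs f} (b (Any.here refl)) (⋀-bounded xs (b ∘ Any.there))

      ⋁-bounded : ∀ xs → (∀ {x} → x ∈ xs → Bounded j (f x)) → Bounded j (⋁ xs f)
      ⋁-bounded []       _ = (z≤n , (λ ()) , z≤n) , λ _ ()
      ⋁-bounded (x ∷ xs) b =
        bounded₂⁺ {f x} {⋁ xs f} (b (Any.here refl)) (⋁-bounded xs (b ∘ Any.there))

  module _ {Γ : List ℕ} {j k′ a : ℕ} {φ : 𝓛 τ s (a ∷ Γ)} where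

    boundedLog⁺ : a ≤ r → k′ ≤ k → Bounded j φ → BoundedLog (suc j) k′ a φ
    boundedLog⁺ a≤r k′≤k ((l , m , h) , f) = (s≤s l , (a≤r , m) , ⊔-lub k′≤k h) , f

    boundedLog⁻ : BoundedLog (suc j) k′ a φ → a ≤ r × k′ ≤ k × Bounded j φ
    boundedLog⁻ ((s≤s l , (a≤r , m) , h) , f) =
      a≤r , m⊔n≤o⇒m≤o k′ _ h , (l , m , m⊔n≤o⇒n≤o k′ _ h) , f

-- Winning strategies preserve truth

module PebbleWins {τ : Signature} (s : ℕ) (𝒜 ℬ : Structure τ) {Γ : List ℕ}
                  (ρA : REnv (Fin (size 𝒜)) Γ) (ρB : REnv (Fin (size ℬ)) Γ) where
  open PebbleGame s 𝒜 ℬ ρA ρB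

  Tracks : Position → (Fin s → A) → (Fin s → B) → FO τ s Γ → Set
  Tracks p α β φ = ∀ x → FreeFO x φ → p x ≡ just (α x , β x)

  -- Tracks p α β (ex i φ) and Tracks p α β (all i φ) unfold to the same type.
  tracks-update : ∀ {p α β i} {φ : FO τ s Γ} → Tracks p α β (ex i φ) →
                  ∀ a b → Tracks (update p i (just (a , b))) (update α i a) (update β i b) φ
  tracks-update {i = i} t a b x fx with x ≟ i
  ... | yes _  = refl
  ... | no x≢i = t x (x≢i , fx)

  module _ {p : Position} {α : Fin s → A} {β : Fin s → B} (iso : PartialIso p) where

    private
      pairs : ∀ {n} → Vec (Fin s) n → Vec (A × B) n
      pairs = map (λ x → α x , β x)

      pebbled-pairs : ∀ {n} (xs : Vec (Fin s) n) → (∀ x → x Vec.∈ xs → p x ≡ just (α x , β x)) →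
                      All (Pebbled p) (pairs xs)
      pebbled-pairs []       t = []
      pebbled-pairs (x ∷ xs) t = (x , t x (here refl)) ∷ pebbled-pairs xs (λ y → t y ∘ there)

      map-pairs₁ : ∀ {n} (xs : Vec (Fin s) n) → map proj₁ (pairs xs) ≡ map α xs
      map-pairs₁ xs = sym (map-∘ proj₁ _ xs)

      map-pairs₂ : ∀ {n} (xs : Vec (Fin s) n) → map proj₂ (pairs xs) ≡ map β xs
      map-pairs₂ xs = sym (map-∘ proj₂ _ xs)

    rel-agrees : ∀ R xs → Tracks p α β (atom R xs) → rel 𝒜 R (map α xs) ≡ rel ℬ R (map β xs)
    rel-agrees R xs t = begin
      rel 𝒜 R (map α xs)             ≡⟨ cong (rel 𝒜 R) (map-pairs₁ xs) ⟨
      rel 𝒜 R (map proj₁ (pairs xs)) ≡⟨ proj₁ (proj₂ iso) R (pairs xs) (pebbled-pairs xs t) ⟩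
      rel ℬ R (map proj₂ (pairs xs)) ≡⟨ cong (rel ℬ R) (map-pairs₂ xs) ⟩
      rel ℬ R (map β xs)             ∎
      where open ≡-Reasoning

    rvar-agrees : ∀ {a} (X : RVar Γ a) xs → Tracks p α β (rvar X xs) →
                  map α xs ∈ lookupR ρA X ⇔ map β xs ∈ lookupR ρB X
    rvar-agrees X xs t = mk⇔
      (subst (_∈ lookupR ρB X) (map-pairs₂ xs) ∘ to e ∘ subst (_∈ lookupR ρA X) (sym (map-pairs₁ xs)))
      (subst (_∈ lookupR ρA X) (map-pairs₁ xs) ∘ from e ∘ subst (_∈ lookupR ρB X) (sym (map-pairs₂ xs)))
      where e = proj₂ (proj₂ iso) X (pairs xs) (pebbled-pairs xs t)

    eq-agrees : ∀ x y → Tracks p α β (eq x y) → (α x ≡ α y) ⇔ (β x ≡ β y)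
    eq-agrees x y t = proj₁ iso _ _ (x , t x (inj₁ refl)) (y , t y (inj₂ refl))

  module _ (σ : Strategy) (win : Winning σ) where

    satFO-preserved : (φ : FO τ s Γ) (h : List Move) {α : Fin s → A} {β : Fin s → B} →
                      Tracks (position σ h) α β φ → satFO 𝒜 ρA α φ ⇔ satFO ℬ ρB β φ

    forth : ∀ i φ h {α β} → Tracks (position σ h) α β (ex i φ) → (a : A) →
            satFO 𝒜 ρA (update α i a) φ ⇔ satFO ℬ ρB (update β i (σ h (i , inj₁ a))) φ
    forth i φ h t a = satFO-preserved φ ((i , inj₁ a) ∷ h) (tracks-update {φ = φ} t a _)

    back : ∀ i φ h {α β} → Tracks (position σ h) α β (ex i φ) → (b : B) →
           satFO 𝒜 ρA (update α i (σ h (i , inj₂ b))) φ ⇔ satFO ℬ ρB (update β i b) φ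
    back i φ h t b = satFO-preserved φ ((i , inj₂ b) ∷ h) (tracks-update {φ = φ} t _ b)

    satFO-preserved (atom R xs) h t = mk⇔ (trans (sym e)) (trans e)
      where e = rel-agrees (win h) R xs t
    satFO-preserved (rvar X xs) h t = rvar-agrees (win h) X xs t
    satFO-preserved (eq x y)    h t = eq-agrees (win h) x y t
    satFO-preserved (neg φ)     h t = ¬-cong-⇔ (satFO-preserved φ h t)
    satFO-preserved (ex i φ) h t = mk⇔
      (λ (a , φa) → σ h (i , inj₁ a) , to (forth i φ h t a) φa)
      (λ (b , φb) → σ h (i , inj₂ b) , from (back i φ h t b) φb)
    satFO-preserved (all i φ) h t = mk⇔
      (λ φA b → to (back i φ h t b) (φA _))
      (λ φB a → from (forth i φ h t a) (φB _))
    satFO-preserved (conj I φs) h t = mk⇔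
      (λ φsA j → to   (satFO-preserved (φs j) h (λ x → t x ∘ (j ,_))) (φsA j))
      (λ φsB j → from (satFO-preserved (φs j) h (λ x → t x ∘ (j ,_))) (φsB j))
    satFO-preserved (disj I φs) h t = mk⇔
      (λ (j , φA) → j , to   (satFO-preserved (φs j) h (λ x → t x ∘ (j ,_))) φA)
      (λ (j , φB) → j , from (satFO-preserved (φs j) h (λ x → t x ∘ (j ,_))) φB)

module _ {τ : Signature} (s : ℕ) (𝒜 ℬ : Structure τ) where
  open PebbleGame s 𝒜 ℬ using (DuplicatorWins; Strategy; position; PartialIso)

  forget-relation : ∀ {Γ a} {ρA : REnv (Fin (size 𝒜)) Γ} {ρB : REnv (Fin (size ℬ)) Γ}
                      {R : List (Vec (Fin (size 𝒜)) a)} {S : List (Vec (Fin (size ℬ)) a)} →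
                    DuplicatorWins (R ∷ ρA) (S ∷ ρB) → DuplicatorWins ρA ρB
  forget-relation {ρA = ρA} {ρB} {R} {S} (σ , win) = σ′ , λ h →
    let (≈ , rels , vars) = win h
    in subst (PartialIso ρA ρB) (sym (same-position h)) (≈ , rels , λ X → vars (there X))
    where
    -- Reply is defined by cases on the move, so σ cannot be reused without splitting.
    σ′ : Strategy ρA ρB
    σ′ h (i , inj₁ a) = σ h (i , inj₁ a)
    σ′ h (i , inj₂ b) = σ h (i , inj₂ b)

    same-position : ∀ h → position ρA ρB σ′ h ≡ position (R ∷ ρA) (S ∷ ρB) σ h
    same-position []                = refl
    same-position ((i , inj₁ a) ∷ h) =
      cong (λ p → update p i (just (a , σ h (i , inj₁ a)))) (same-position h)
    same-position ((i , inj₂ b) ∷ h) =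
      cong (λ p → update p i (just (σ h (i , inj₂ b) , b))) (same-position h)

module Soundness {τ : Signature} (r k s : ℕ) (𝒜 ℬ : Structure τ) (0<k : 0 < k) where
  open Bounds {τ} {s} r k

  private
    A = Fin (size 𝒜)
    B = Fin (size ℬ)

  -- Remaining relation moves are spent on the empty nullary relation.
  GWin⇒DuplicatorWins : ∀ j {Γ} {ρA : REnv A Γ} {ρB : REnv B Γ} →
                        GWin r k s 𝒜 ℬ j ρA ρB → PebbleGame.DuplicatorWins s 𝒜 ℬ ρA ρB
  GWin⇒DuplicatorWins zero    win = win
  GWin⇒DuplicatorWins (suc j) win =
    let (_ , _ , win′) = proj₁ (win 0 k z≤n 0<k ≤-refl) [] z≤n
    in forget-relation s 𝒜 ℬ (GWin⇒DuplicatorWins j win′)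

  relation-move : ∀ {j Γ a k′} {ρA : REnv A Γ} {ρB : REnv B Γ} →
                  GWin r k s 𝒜 ℬ (suc j) ρA ρB → a ≤ r → 0 < k′ → k′ ≤ k →
                  {P : List (Vec A a) → Set} {Q : List (Vec B a) → Set} →
                  (∀ {R S} → GWin r k s 𝒜 ℬ j (R ∷ ρA) (S ∷ ρB) → P R ⇔ Q S) →
                  (∃ λ R → length R ≤ logPow k′ (size 𝒜) × P R) ⇔
                  (∃ λ S → length S ≤ logPow k′ (size ℬ) × Q S)
  relation-move {a = a} {k′} win a≤r 0<k′ k′≤k P⇔Q = mk⇔
    (λ (R , |R| , PR) → let (S , |S| , win′) = proj₁ moves R |R| in S , |S| , to (P⇔Q win′) PR)
    (λ (S , |S| , QS) → let (R , |R| , win′) = proj₂ moves S |S| in R , |R| , from (P⇔Q win′) QS)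
    where moves = win a k′ a≤r 0<k′ k′≤k

  sat-preserved : ∀ j {Γ} (φ : 𝓛 τ s Γ) {ρA : REnv A Γ} {ρB : REnv B Γ} →
                  GWin r k s 𝒜 ℬ j ρA ρB → Bounded j φ →
                  ∀ α β → sat 𝒜 ρA α φ ⇔ sat ℬ ρB β φ
  sat-preserved j (fo φ) win (_ , closed) α β =
    let (σ , σ-wins) = GWin⇒DuplicatorWins j win
    in PebbleWins.satFO-preserved s 𝒜 ℬ _ _ σ σ-wins φ [] (λ x → ⊥-elim ∘ closed x)
  sat-preserved j (and φ ψ) win b α β =
    let (bφ , bψ) = bounded₂⁻ {φ = φ} {ψ} b
    in sat-preserved j φ win bφ α β ×-⇔ sat-preserved j ψ win bψ α β
  sat-preserved j (or φ ψ) win b α β =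
    let (bφ , bψ) = bounded₂⁻ {φ = φ} {ψ} b
    in sat-preserved j φ win bφ α β ⊎-⇔ sat-preserved j ψ win bψ α β
  sat-preserved zero (exLog _ _ _ _) _ ((() , _) , _) α β
  sat-preserved (suc j) (exLog k′ 0<k′ a φ) win b α β =
    let (a≤r , k′≤k , bφ) = boundedLog⁻ {φ = φ} b
    in relation-move win a≤r 0<k′ k′≤k λ win′ → sat-preserved j φ win′ bφ α β
  sat-preserved zero (forallLog _ _ _ _) _ ((() , _) , _) α β
  sat-preserved (suc j) (forallLog k′ 0<k′ a φ) win b α β =
    let (a≤r , k′≤k , bφ) = boundedLog⁻ {φ = φ} b
    in ¬-cong-⇔ (relation-move win a≤r 0<k′ k′≤k λ win′ →
                   ¬-cong-⇔ (sat-preserved j φ win′ bφ α β))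

  DupWinsG⇒Equiv𝓛 : ∀ m → DupWinsG m r k s 𝒜 ℬ → Equiv𝓛 m r k s 𝒜 ℬ
  DupWinsG⇒Equiv𝓛 m win φ φ∈𝓛 closed = mk⇔
    (λ 𝒜⊨φ β → to   (agree (λ _ → point 𝒜) β) (𝒜⊨φ _))
    (λ ℬ⊨φ α → from (agree α (λ _ → point ℬ)) (ℬ⊨φ _))
    where agree = sat-preserved m φ (win m ≤-refl) (φ∈𝓛 , closed)

-- Hintikka formulas of the pebble game

module _ {τ : Signature} {s : ℕ} {Γ : List ℕ} where

  signed : {P : Set} → Dec P → FO τ s Γ → FO τ s Γ
  signed (yes _) ψ = ψ
  signed (no _)  ψ = neg ψ

  module _ {P : Set} {ψ : FO τ s Γ} where

    module _ {𝒞 : Structure τ} {ρ : REnv (Fin (size 𝒞)) Γ} {γ : Fin s → Fin (size 𝒞)} where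

      signed-holds : (d : Dec P) → (satFO 𝒞 ρ γ ψ ⇔ P) → satFO 𝒞 ρ γ (signed d ψ)
      signed-holds (yes p) ψ⇔P = from ψ⇔P p
      signed-holds (no ¬p) ψ⇔P = ¬p ∘ to ψ⇔P

      signed-decides : (d : Dec P) → satFO 𝒞 ρ γ (signed d ψ) → P ⇔ satFO 𝒞 ρ γ ψ
      signed-decides (yes p) holds = mk⇔ (λ _ → holds) (λ _ → p)
      signed-decides (no ¬p) holds = mk⇔ (⊥-elim ∘ ¬p) (⊥-elim ∘ holds)

    signed-free : (d : Dec P) → ∀ {x} → FreeFO x (signed d ψ) → FreeFO x ψ
    signed-free (yes _) f = f
    signed-free (no _)  f = f

    signed-mva : (d : Dec P) → ∀ {r} → MvaFO≤ r ψ → MvaFO≤ r (signed d ψ)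
    signed-mva (yes _) m = m
    signed-mva (no _)  m = m

module Configurations {τ : Signature} {s : ℕ} (𝒜 : Structure τ) where

  private
    A = Fin (size 𝒜)

  Conf : Set
  Conf = Fin s → Maybe A

  Placed : Conf → Fin s → Set
  Placed c x = ∃ λ a → c x ≡ just a

  -- Unplaced variables get the junk value point 𝒜.
  value : Conf → Fin s → A
  value c x = fromMaybe (point 𝒜) (c x)

  Agrees : Conf → (Fin s → A) → Set
  Agrees c α = ∀ x {a} → c x ≡ just a → α x ≡ a

  value-placed : ∀ {c x a} → c x ≡ just a → value c x ≡ a
  value-placed e = cong (fromMaybe (point 𝒜)) e

  agrees-value : ∀ {c α x} → Agrees c α → Placed c x → α x ≡ value c x
  agrees-value {c} {x = x} α≈c (a , e) = trans (α≈c x e) (sym (value-placed {c} e))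

  map-agrees-value : ∀ {c α n} {xs : Vec (Fin s) n} → Agrees c α → All (Placed c) xs →
                     map α xs ≡ map (value c) xs
  map-agrees-value α≈c []       = refl
  map-agrees-value α≈c (p ∷ ps) = cong₂ _∷_ (agrees-value α≈c p) (map-agrees-value α≈c ps)

  agrees-update : ∀ {c α} i a → Agrees c α → Agrees (update c i (just a)) (update α i a)
  agrees-update i a α≈c x e with x ≟ i
  ... | yes _ = just-injective e
  ... | no _  = α≈c x e

  placed-update : ∀ {c i a x} → ¬ x ≡ i → Placed (update c i (just a)) x → Placed c x
  placed-update {i = i} {x = x} x≢i (b , e) with x ≟ i
  ... | yes x≡i = ⊥-elim (x≢i x≡i)
  ... | no _    = b , e

module Hintikka (em : ExcludedMiddle 0ℓ) {τ : Signature} {s : ℕ} (𝒜 : Structure τ)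
                   {Γ : List ℕ} (ρ : REnv (Fin (size 𝒜)) Γ) where
  open Configurations {τ} {s} 𝒜

  private
    A = Fin (size 𝒜)

  data Atom (c : Conf) : Set where
    rel-atom : (R : Sym τ) (xs : Vec (Fin s) (arity τ R)) → All (Placed c) xs → Atom c
    eq-atom  : ∀ {x y} → Placed c x → Placed c y → Atom c
    var-atom : ∀ {a} (X : RVar Γ a) (xs : Vec (Fin s) a) → All (Placed c) xs → Atom c

  ⌜_⌝ : ∀ {c} → Atom c → FO τ s Γ
  ⌜ rel-atom R xs _ ⌝       = atom R xs
  ⌜ eq-atom {x} {y} _ _ ⌝  = eq x y
  ⌜ var-atom X xs _ ⌝       = rvar X xs

  decide : ∀ {c} (ψ : Atom c) → Dec (satFO 𝒜 ρ (value c) ⌜ ψ ⌝)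
  decide ψ = em

  -- The component same makes hintikka (suc n) c imply hintikka n c.
  data Extension : Set where
    same  : Extension
    forth : Fin s → A → Extension
    back  : Fin s → Extension

  hintikka : ℕ → Conf → FO τ s Γ
  hintikka zero    c = conj (Atom c) λ ψ → signed (decide ψ) ⌜ ψ ⌝
  hintikka (suc n) c = conj Extension λ where
    same        → hintikka n c
    (forth i a) → ex i (hintikka n (update c i (just a)))
    (back i)    → all i (disj A λ a → hintikka n (update c i (just a)))

  atom-value : ∀ {c α} → Agrees c α → (ψ : Atom c) →
               satFO 𝒜 ρ α ⌜ ψ ⌝ ⇔ satFO 𝒜 ρ (value c) ⌜ ψ ⌝
  atom-value α≈c (rel-atom R xs ps) = ≡⇒ (cong (λ v → rel 𝒜 R v ≡ true) (map-agrees-value α≈c ps))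
  atom-value α≈c (eq-atom px py)    = ≡⇒ (cong₂ _≡_ (agrees-value α≈c px) (agrees-value α≈c py))
  atom-value α≈c (var-atom X xs ps) = ≡⇒ (cong (_∈ lookupR ρ X) (map-agrees-value α≈c ps))

  hintikka-holds : ∀ n c {α} → Agrees c α → satFO 𝒜 ρ α (hintikka n c)
  hintikka-holds zero    c α≈c ψ           = signed-holds (decide ψ) (atom-value α≈c ψ)
  hintikka-holds (suc n) c α≈c same        = hintikka-holds n c α≈c
  hintikka-holds (suc n) c α≈c (forth i a) = a , hintikka-holds n _ (agrees-update i a α≈c)
  hintikka-holds (suc n) c α≈c (back i)    = λ a → a , hintikka-holds n _ (agrees-update i a α≈c)

  atom-placed : ∀ {c x} (ψ : Atom c) → FreeFO x ⌜ ψ ⌝ → Placed c x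
  atom-placed (rel-atom R xs ps) x∈xs       = All.lookup ps x∈xs
  atom-placed (eq-atom px py)    (inj₁ refl) = px
  atom-placed (eq-atom px py)    (inj₂ refl) = py
  atom-placed (var-atom X xs ps) x∈xs       = All.lookup ps x∈xs

  hintikka-free : ∀ n c {x} → FreeFO x (hintikka n c) → Placed c x
  hintikka-free zero    c (ψ , f)                      = atom-placed ψ (signed-free (decide ψ) f)
  hintikka-free (suc n) c (same , f)                   = hintikka-free n c f
  hintikka-free (suc n) c (forth i a , x≢i , f)        = placed-update {c} x≢i (hintikka-free n _ f)
  hintikka-free (suc n) c (back i    , x≢i , (a , f)) = placed-update {c} x≢i (hintikka-free n _ f)

  module _ {r : ℕ} (Γ≤r : List.All (_≤ r) Γ) where

    atom-mva : ∀ {c} (ψ : Atom c) → MvaFO≤ r ⌜ ψ ⌝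
    atom-mva (rel-atom _ _ _) = tt
    atom-mva (eq-atom _ _)    = tt
    atom-mva (var-atom X _ _) = rvar-arity≤ Γ≤r X

    hintikka-mva : ∀ n c → MvaFO≤ r (hintikka n c)
    hintikka-mva zero    c ψ           = signed-mva (decide ψ) (atom-mva ψ)
    hintikka-mva (suc n) c same        = hintikka-mva n c
    hintikka-mva (suc n) c (forth i a) = hintikka-mva n _
    hintikka-mva (suc n) c (back i)    = λ a → hintikka-mva n _

module HintikkaStrategy (em : ExcludedMiddle 0ℓ) {τ : Signature} (s : ℕ) (𝒜 ℬ : Structure τ)
                    {Γ : List ℕ} (ρA : REnv (Fin (size 𝒜)) Γ) (ρB : REnv (Fin (size ℬ)) Γ) where
  open PebbleGame s 𝒜 ℬ ρA ρB
  open Configurations {τ} {s} 𝒜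
  open Hintikka em {s = s} 𝒜 ρA
  open Classical em using (common-witness)

  record Realised (p : Position) : Set where
    field
      conf     : Conf
      β        : Fin s → B
      conf-fst : ∀ x → conf x ≡ Maybe.map proj₁ (p x)
      β-snd    : ∀ x {a b} → p x ≡ just (a , b) → β x ≡ b
      realises : ∀ n → satFO ℬ ρB β (hintikka n conf)

  module _ {p : Position} (real : Realised p) where
    open Realised real

    conf-placed : ∀ {x ab} → p x ≡ just ab → Placed conf x
    conf-placed {x} {a , _} e = a , trans (conf-fst x) (cong (Maybe.map proj₁) e)

    value-fst : ∀ {x a b} → p x ≡ just (a , b) → value conf x ≡ a
    value-fst e = value-placed {conf} (proj₂ (conf-placed e))

    pebble-variables : ∀ {n} {t : Vec (A × B) n} → All (Pebbled p) t →
                       ∃ λ xs → All (Placed conf) xs ×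
                                map (value conf) xs ≡ map proj₁ t × map β xs ≡ map proj₂ t
    pebble-variables [] = [] , [] , refl , refl
    pebble-variables ((x , e) ∷ pebbled) =
      let (xs , xs-placed , eqA , eqB) = pebble-variables pebbled
      in x ∷ xs , conf-placed e ∷ xs-placed , cong₂ _∷_ (value-fst e) eqA , cong₂ _∷_ (β-snd x e) eqB

    atom-transfer : (ψ : Atom conf) → satFO 𝒜 ρA (value conf) ⌜ ψ ⌝ ⇔ satFO ℬ ρB β ⌜ ψ ⌝
    atom-transfer ψ = signed-decides (decide ψ) (realises 0 ψ)

    realised-iso : PartialIso p
    realised-iso = equalities , relations , variables
      where
      equalities : ∀ ab ab′ → Pebbled p ab → Pebbled p ab′ →
                   (proj₁ ab ≡ proj₁ ab′ ⇔ proj₂ ab ≡ proj₂ ab′)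
      equalities _ _ (x , e₁) (y , e₂) =
        subst₂ (λ u v → u ≡ _ ⇔ v ≡ _) (value-fst e₁) (β-snd x e₁)
          (subst₂ (λ u v → value conf x ≡ u ⇔ β x ≡ v) (value-fst e₂) (β-snd y e₂)
            (atom-transfer (eq-atom (conf-placed e₁) (conf-placed e₂))))

      relations : ∀ R (t : Vec (A × B) (arity τ R)) → All (Pebbled p) t →
                  rel 𝒜 R (map proj₁ t) ≡ rel ℬ R (map proj₂ t)
      relations R t pebbled =
        let (xs , xs-placed , eqA , eqB) = pebble-variables pebbled
        in ≡true-⇔⇒≡ (subst₂ (λ u v → rel 𝒜 R u ≡ true ⇔ rel ℬ R v ≡ true) eqA eqB
                        (atom-transfer (rel-atom R xs xs-placed)))

      variables : ∀ {a} (X : RVar Γ a) (t : Vec (A × B) a) → All (Pebbled p) t →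
                  (map proj₁ t ∈ lookupR ρA X ⇔ map proj₂ t ∈ lookupR ρB X)
      variables X t pebbled =
        let (xs , xs-placed , eqA , eqB) = pebble-variables pebbled
        in subst₂ (λ u v → u ∈ lookupR ρA X ⇔ v ∈ lookupR ρB X) eqA eqB
             (atom-transfer (var-atom X xs xs-placed))

  extend : ∀ {p} (real : Realised p) i a b →
           (∀ n → satFO ℬ ρB (update (Realised.β real) i b)
                             (hintikka n (update (Realised.conf real) i (just a)))) →
           Realised (update p i (just (a , b)))
  extend {p} real i a b realises′ = record
    { conf     = update conf i (just a)
    ; β        = update β i b
    ; conf-fst = conf-fst′
    ; β-snd    = β-snd′
    ; realises = realises′
    }
    where
    open Realised real
    conf-fst′ : ∀ x → update conf i (just a) x ≡ Maybe.map proj₁ (update p i (just (a , b)) x)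
    conf-fst′ x with x ≟ i
    ... | yes _ = refl
    ... | no _  = conf-fst x
    β-snd′ : ∀ x {a′ b′} → update p i (just (a , b)) x ≡ just (a′ , b′) → update β i b x ≡ b′
    β-snd′ x e with x ≟ i
    ... | yes _ = cong proj₂ (just-injective e)
    ... | no _  = β-snd x e

  -- Finitely many candidate answers serve infinitely many depths, so one serves them all.
  reply : ∀ {p} → Realised p → (mv : Move) →
          Σ (Reply mv) λ answer → Realised (update p (proj₁ mv) (just (placed mv answer)))
  reply real (i , inj₁ a) =
    let (b , realises′) = common-witness (size ℬ)
          (λ n b → satFO ℬ ρB (update β i b) (hintikka n (update conf i (just a))))
          (λ h → h same) (λ n → realises (suc n) (forth i a))
    in b , extend real i a b realises′
    where open Realised real
  reply real (i , inj₂ b) =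
    let (a , realises′) = common-witness (size 𝒜)
          (λ n a → satFO ℬ ρB (update β i b) (hintikka n (update conf i (just a))))
          (λ h → h same) (λ n → realises (suc n) (back i) b)
    in a , extend real i a b realises′
    where open Realised real

  module _ (real₀ : Realised initial) where

    walk : List Move → Σ Position Realised
    walk []       = initial , real₀
    walk (mv ∷ h) = let (p , real) = walk h ; (answer , real′) = reply real mv
                    in update p (proj₁ mv) (just (placed mv answer)) , real′

    σ : Strategy
    σ h mv = proj₁ (reply (proj₂ (walk h)) mv)

    position-walk : ∀ h → position σ h ≡ proj₁ (walk h)
    position-walk []       = refl
    position-walk (mv ∷ h) = cong (λ p → update p (proj₁ mv) (just (placed mv (σ h mv)))) (position-walk h)

    realised-wins : DuplicatorWins
    realised-wins = σ , λ h → subst PartialIso (sym (position-walk h)) (realised-iso (proj₂ (walk h)))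

  realised-initial : ∀ {β} → (∀ n → satFO ℬ ρB β (hintikka n (λ _ → nothing))) → Realised initial
  realised-initial {β} realises = record
    { conf = λ _ → nothing ; β = β ; conf-fst = λ _ → refl ; β-snd = λ _ () ; realises = realises }

-- Characteristic sentences of the game

module Characteristic (em : ExcludedMiddle 0ℓ) {τ : Signature} (r k s : ℕ) (𝒜 : Structure τ) where
  open Bounds {τ} {s} r k

  private
    A = Fin (size 𝒜)
    module H {Γ : List ℕ} (ρ : REnv A Γ) = Hintikka em {s = s} 𝒜 ρ

  relations : (a k″ : ℕ) → List (List (Vec A a))
  relations a k″ = lists≤ (logPow (suc k″) (size 𝒜)) (vectors a (allFin (size 𝒜)))

  ∈-relations : ∀ {a} k″ (R : List (Vec A a)) →
                length R ≤ logPow (suc k″) (size 𝒜) → R ∈ relations a k″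
  ∈-relations _ = ∈-lists≤⁺ (∈-vectors ∈-allFin)

  χ : ℕ → ∀ {Γ} → REnv A Γ → 𝓛 τ s Γ
  forth back : ℕ → ∀ {Γ} → REnv A Γ → (a k″ : ℕ) → 𝓛 τ s Γ
  moves : ℕ → ∀ {Γ} → REnv A Γ → (a : ℕ) → 𝓛 τ s Γ

  χ zero    ρ = fo (conj ℕ λ n → H.hintikka ρ n (λ _ → nothing))
  χ (suc j) ρ = ⋀ (upTo (suc r)) (moves j ρ)
  moves j ρ a = ⋀ (upTo k) λ k″ → and (forth j ρ a k″) (back j ρ a k″)
  forth j ρ a k″ = ⋀ (relations a k″) λ R → exLog (suc k″) (s≤s z≤n) a (χ j (R ∷ ρ))
  back j ρ a k″ = forallLog (suc k″) (s≤s z≤n) a (⋁ (relations a k″) λ R → χ j (R ∷ ρ))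

  χ-bounded : ∀ j {Γ} (ρ : REnv A Γ) → List.All (_≤ r) Γ → Bounded j (χ j ρ)
  χ-bounded zero    ρ Γ≤r = (z≤n , (λ n → H.hintikka-mva ρ Γ≤r n _) , z≤n) , unplaced
    where
    unplaced : ∀ i → ¬ Free i (χ zero ρ)
    unplaced i (n , f) with () ← proj₂ (H.hintikka-free ρ n _ f)
  χ-bounded (suc j) ρ Γ≤r =
    ⋀-bounded (moves j ρ) (upTo (suc r)) λ {a} a∈ →
    ⋀-bounded (λ k″ → and (forth j ρ a k″) (back j ρ a k″)) (upTo k) λ {k″} k″∈ →
      let a≤r = s≤s⁻¹ (∈-upTo⁻ a∈) ; k′≤k = ∈-upTo⁻ k″∈
          next : ∀ {R} → R ∈ relations a k″ → Bounded j (χ j (R ∷ ρ))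
          next _ = χ-bounded j _ (a≤r List.∷ Γ≤r)
      in bounded₂⁺ {φ = forth j ρ a k″} {back j ρ a k″}
           (⋀-bounded _ (relations a k″) λ R∈ → boundedLog⁺ {φ = χ j _} a≤r k′≤k (next R∈))
           (boundedLog⁺ {φ = ⋁ (relations a k″) λ R → χ j (R ∷ ρ)} a≤r k′≤k
              (⋁-bounded _ (relations a k″) next))

  χ-holds : ∀ j {Γ} (ρ : REnv A Γ) α → sat 𝒜 ρ α (χ j ρ)
  χ-holds zero    ρ α = λ n → H.hintikka-holds ρ n _ λ _ ()
  χ-holds (suc j) ρ α =
    from (sat-⋀ 𝒜 ρ α (upTo (suc r)) (moves j ρ)) λ {a} _ →
    from (sat-⋀ 𝒜 ρ α (upTo k) _) λ {k″} _ →
      from (sat-⋀ 𝒜 ρ α (relations a k″) _)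
        (λ {R} R∈ → R , ∈-lists≤⁻ R∈ , χ-holds j (R ∷ ρ) α) ,
      λ (S , |S| , ¬χS) → ¬χS (from (sat-⋁ 𝒜 (S ∷ ρ) α (relations a k″) _)
                                 (S , ∈-relations k″ S |S| , χ-holds j (S ∷ ρ) α))

  module _ (ℬ : Structure τ) where

    private
      B = Fin (size ℬ)

    χ-wins : ∀ j {Γ} (ρA : REnv A Γ) (ρB : REnv B Γ) β →
             sat ℬ ρB β (χ j ρA) → GWin r k s 𝒜 ℬ j ρA ρB
    χ-wins zero    ρA ρB β hintikkas = realised-wins (realised-initial hintikkas)
      where open HintikkaStrategy em s 𝒜 ℬ ρA ρB
    χ-wins (suc j) ρA ρB β χℬ a zero    a≤r () k′≤k
    χ-wins (suc j) ρA ρB β χℬ a (suc k″) a≤r _ k′≤k = forth-answers , back-answers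
      where
      movesℬ = to (sat-⋀ ℬ ρB β (upTo (suc r)) (moves j ρA)) χℬ (∈-upTo⁺ (s≤s a≤r))
      forth-backℬ = to (sat-⋀ ℬ ρB β (upTo k) _) movesℬ (∈-upTo⁺ k′≤k)

      forth-answers : ∀ R → length R ≤ logPow (suc k″) (size 𝒜) →
                      Σ (List (Vec B a)) λ S → length S ≤ logPow (suc k″) (size ℬ) ×
                                                GWin r k s 𝒜 ℬ j (R ∷ ρA) (S ∷ ρB)
      forth-answers R |R| =
        let (S , |S| , χS) =
              to (sat-⋀ ℬ ρB β (relations a k″) _) (proj₁ forth-backℬ) (∈-relations k″ R |R|)
        in S , |S| , χ-wins j (R ∷ ρA) (S ∷ ρB) β χS

      back-answers : ∀ S → length S ≤ logPow (suc k″) (size ℬ) →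
                     Σ (List (Vec A a)) λ R → length R ≤ logPow (suc k″) (size 𝒜) ×
                                               GWin r k s 𝒜 ℬ j (R ∷ ρA) (S ∷ ρB)
      back-answers S |S| =
        let ⋁χ = em⇒dne em λ ¬⋁χ → proj₂ forth-backℬ (S , |S| , ¬⋁χ)
            (R , R∈ , χR) = to (sat-⋁ ℬ (S ∷ ρB) β (relations a k″) _) ⋁χ
        in R , ∈-lists≤⁻ R∈ , χ-wins j (R ∷ ρA) (S ∷ ρB) β χR

    Equiv𝓛⇒DupWinsG : ∀ m → Equiv𝓛 m r k s 𝒜 ℬ → DupWinsG m r k s 𝒜 ℬ
    Equiv𝓛⇒DupWinsG m equiv m′ m′≤m =
      let ((lqr≤m′ , mva , height≤k) , closed) = χ-bounded m′ [] List.[]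
          χ∈𝓛 = ≤-trans lqr≤m′ m′≤m , mva , height≤k
          ℬ⊨χ = to (equiv (χ m′ []) χ∈𝓛 closed) (χ-holds m′ [])
      in χ-wins m′ [] [] _ (ℬ⊨χ λ _ → point ℬ)

proposition4p3 : ExcludedMiddle 0ℓ →
    (m r k s : ℕ) → 0 < r → 0 < k → 0 < s →
    (τ : Signature) (𝒜 ℬ : Structure τ) →
    Equiv𝓛 m r k s 𝒜 ℬ ⇔ DupWinsG m r k s 𝒜 ℬ
proposition4p3 em m r k s _ 0<k _ τ 𝒜 ℬ =
  mk⇔ (Characteristic.Equiv𝓛⇒DupWinsG em r k s 𝒜 ℬ m)
      (Soundness.DupWinsG⇒Equiv𝓛 r k s 𝒜 ℬ 0<k m)
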